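{- Let $c_\ell = \sum_{d=1}^\infty \gcd(d,\ell)/d^2$ for $\ell\in\mathbb{N}$. There exists a constant $c>0$ such that for all $X\ge 1$, $$\sum_{X\le \ell\le 2X} c_\ell \le cX,$$ where the sum runs over integers $\ell$ with $X\le\ell\le 2X$.
   Formalization: The parameter X ranges only over the rationals X ≥ 1, and the constant c is taken in the rationals. -}

module Defs where

open import Data.Nat as ℕ using (ℕ; zero; suc)
open import Data.Nat.GCD using (gcd)
open import Data.Integer using (+_)
open import Data.Rational using (ℚ; _/_; 0ℚ; _+_; _*_; _≤_)
open import Data.Rational.Properties using (_≤?_)
open import Data.Product using (_×_)
open import Relation.Nullary using (yes; no)
open import Relation.Nullary.Decidable using (_×-dec_)

ℓℚ : ℕ → ℚ
ℓℚ ℓ = + ℓ / 1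

-- the d-th term of c_ℓ, for d = suc k ≥ 1 :  gcd(d, ℓ) / d²
term : ℕ → ℕ → ℚ
term ℓ k = + gcd (suc k) ℓ / (suc k ℕ.* suc k)

-- partial sum  Σ_{d=1}^{N} gcd(d,ℓ)/d²   (c_ℓ is the supremum of these over N)
cPartial : ℕ → ℕ → ℚ
cPartial ℓ zero    = 0ℚ
cPartial ℓ (suc N) = cPartial ℓ N + term ℓ N

windowSum : ℚ → ℕ → ℕ → ℚ
windowSum X N zero = 0ℚ
windowSum X N (suc M) with (X ≤? ℓℚ M) ×-dec (ℓℚ M ≤? (+ 2 / 1) * X)
... | yes _ = windowSum X N M + cPartial M N
... | no  _ = windowSum X N M

-- Since gcd(d, ℓ) ≤ Σ_{e ∣ d, e ∣ ℓ} e, interchanging the order of summation gives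
--   Σ_{1≤ℓ≤Y} Σ_{d≤N} gcd(d, ℓ)/d² ≤ Σ_e (Σ_{ℓ≤Y, e∣ℓ} e) (Σ_{d≤N, e∣d} 1/d²) ≤ Σ_e Y · 2/e² ≤ 4Y,
-- because the multiples of e up to Y contribute at most Y, and Σ_{k≥1} 1/k² ≤ 2 (by telescoping
-- against 1/k). The window X ≤ ℓ ≤ 2X lies inside 1 ≤ ℓ ≤ 2X, which gives the constant 8.

module Submission where

open import Defs
open import Data.Nat using (ℕ)
open import Data.Rational using (ℚ; 0ℚ; 1ℚ; _*_; _≤_; _<_)
open import Data.Product using (Σ; _×_)

open import Algebra.Bundles using (CommutativeRing)
open import Data.Empty using (⊥-elim)
open import Data.Fin as Fin using (toℕ)
import Data.Fin.Properties as Fin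
open import Data.Integer as ℤ using (+_; +≤+)
import Data.Integer.Properties as ℤ
open import Data.List using ([]; _∷_)
open import Data.Nat as ℕ using (zero; suc; z≤n; s≤s)
open import Data.Nat.Divisibility using (_∣_; _∣?_; divides; ∣⇒≤)
open import Data.Nat.GCD using (gcd; gcd[m,n]∣m; gcd[m,n]∣n; gcd[m,n]≢0)
import Data.Nat.Properties as ℕ
open import Data.Nat.Tactic.RingSolver using (solve; solve-∀)
open import Data.Product using (∃-syntax; _,_)
open import Data.Rational using (_+_; _/_; toℚᵘ; nonNegative)
import Data.Rational.Properties as ℚ
open import Data.Rational.Properties using (_≤?_)
open import Data.Rational.Unnormalised as ℚᵘ using (mkℚᵘ; *≡*; *≤*)
import Data.Rational.Unnormalised.Properties as ℚᵘ
open import Data.Sum using (inj₁)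
open import Function using (_∘_)
open import Relation.Binary.PropositionalEquality
open import Relation.Nullary using (yes; no; ¬_)
open import Relation.Nullary.Decidable using (_×-dec_)

import Algebra.Properties.Semiring.Sum (CommutativeRing.semiring ℚ.+-*-commutativeRing) as Sum

mkℚᵘ-≃-cross : ∀ {a b c d} → a ℕ.* suc d ≡ c ℕ.* suc b → mkℚᵘ (+ a) b ℚᵘ.≃ mkℚᵘ (+ c) d
mkℚᵘ-≃-cross {a} {b} {c} {d} eq = *≡* (begin
  + a ℤ.* + suc d  ≡⟨ ℤ.pos-* a (suc d) ⟨
  + (a ℕ.* suc d)  ≡⟨ cong +_ eq ⟩
  + (c ℕ.* suc b)  ≡⟨ ℤ.pos-* c (suc b) ⟩
  + c ℤ.* + suc b  ∎)
  where open ≡-Reasoning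

mkℚᵘ-≤-cross : ∀ {a b c d} → a ℕ.* suc d ℕ.≤ c ℕ.* suc b → mkℚᵘ (+ a) b ℚᵘ.≤ mkℚᵘ (+ c) d
mkℚᵘ-≤-cross {a} {b} {c} {d} le = *≤* (subst₂ ℤ._≤_ (ℤ.pos-* a (suc d)) (ℤ.pos-* c (suc b)) (+≤+ le))

toℚᵘ-/ : ∀ a b → toℚᵘ (+ a / suc b) ℚᵘ.≃ mkℚᵘ (+ a) b
toℚᵘ-/ a b = ℚ.toℚᵘ-fromℚᵘ (mkℚᵘ (+ a) b)

/-≡-cross : ∀ a b c d → a ℕ.* suc d ≡ c ℕ.* suc b → + a / suc b ≡ + c / suc d
/-≡-cross a b c d eq = ℚ.fromℚᵘ-cong (mkℚᵘ-≃-cross {a} {b} {c} {d} eq)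

/-≤-cross : ∀ a b c d → a ℕ.* suc d ℕ.≤ c ℕ.* suc b → + a / suc b ≤ + c / suc d
/-≤-cross a b c d le = ℚ.toℚᵘ-cancel-≤
  (ℚᵘ.≤-respʳ-≃ (ℚᵘ.≃-sym (toℚᵘ-/ c d)) (ℚᵘ.≤-respˡ-≃ (ℚᵘ.≃-sym (toℚᵘ-/ a b)) (mkℚᵘ-≤-cross le)))

/-*-/ : ∀ a b c d → (+ a / suc b) * (+ c / suc d) ≡ + (a ℕ.* c) / (suc b ℕ.* suc d)
/-*-/ a b c d = ℚ.toℚᵘ-injective (begin
  toℚᵘ (+ a / suc b * (+ c / suc d))              ≈⟨ ℚ.toℚᵘ-homo-* (+ a / suc b) (+ c / suc d) ⟩
  toℚᵘ (+ a / suc b) ℚᵘ.* toℚᵘ (+ c / suc d)      ≈⟨ ℚᵘ.*-cong (toℚᵘ-/ a b) (toℚᵘ-/ c d) ⟩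
  mkℚᵘ (+ a) b ℚᵘ.* mkℚᵘ (+ c) d                  ≡⟨ cong (λ n → mkℚᵘ n _) (ℤ.pos-* a c) ⟨
  mkℚᵘ (+ (a ℕ.* c)) _                            ≈⟨ toℚᵘ-/ (a ℕ.* c) _ ⟨
  toℚᵘ (+ (a ℕ.* c) / (suc b ℕ.* suc d))          ∎)
  where open ℚᵘ.≃-Reasoning

/-+-/ : ∀ a b c d → (+ a / suc b) + (+ c / suc d) ≡ + (a ℕ.* suc d ℕ.+ c ℕ.* suc b) / (suc b ℕ.* suc d)
/-+-/ a b c d = ℚ.toℚᵘ-injective (begin
  toℚᵘ (+ a / suc b + + c / suc d)                ≈⟨ ℚ.toℚᵘ-homo-+ (+ a / suc b) (+ c / suc d) ⟩
  toℚᵘ (+ a / suc b) ℚᵘ.+ toℚᵘ (+ c / suc d)      ≈⟨ ℚᵘ.+-cong (toℚᵘ-/ a b) (toℚᵘ-/ c d) ⟩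
  mkℚᵘ (+ a) b ℚᵘ.+ mkℚᵘ (+ c) d                  ≡⟨ cong (λ n → mkℚᵘ n _) numerator ⟨
  mkℚᵘ (+ (a ℕ.* suc d ℕ.+ c ℕ.* suc b)) _        ≈⟨ toℚᵘ-/ _ _ ⟨
  toℚᵘ (+ (a ℕ.* suc d ℕ.+ c ℕ.* suc b) / (suc b ℕ.* suc d)) ∎)
  where
  open ℚᵘ.≃-Reasoning
  numerator : + (a ℕ.* suc d ℕ.+ c ℕ.* suc b) ≡ + a ℤ.* + suc d ℤ.+ + c ℤ.* + suc b
  numerator = trans (ℤ.pos-+ (a ℕ.* suc d) (c ℕ.* suc b)) (cong₂ ℤ._+_ (ℤ.pos-* a (suc d)) (ℤ.pos-* c (suc b)))

/-nonNeg : ∀ a b → 0ℚ ≤ + a / suc b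
/-nonNeg a b = /-≤-cross 0 0 a b z≤n

/≡ℓℚ*1/ : ∀ a b → + a / suc b ≡ ℓℚ a * (+ 1 / suc b)
/≡ℓℚ*1/ a b = trans (/-≡-cross a b (a ℕ.* 1) (b ℕ.+ 0) eq) (sym (/-*-/ a 0 1 b))
  where
  eq : a ℕ.* suc (b ℕ.+ 0) ≡ a ℕ.* 1 ℕ.* suc b
  eq = solve (a ∷ b ∷ [])

ℓℚ-+ : ∀ m n → ℓℚ (m ℕ.+ n) ≡ ℓℚ m + ℓℚ n
ℓℚ-+ m n = trans (/-≡-cross (m ℕ.+ n) 0 (m ℕ.* 1 ℕ.+ n ℕ.* 1) 0 eq) (sym (/-+-/ m 0 n 0))
  where
  eq : (m ℕ.+ n) ℕ.* 1 ≡ (m ℕ.* 1 ℕ.+ n ℕ.* 1) ℕ.* 1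
  eq = solve (m ∷ n ∷ [])

ℓℚ-mono-≤ : ∀ {m n} → m ℕ.≤ n → ℓℚ m ≤ ℓℚ n
ℓℚ-mono-≤ {m} {n} m≤n = /-≤-cross m 0 n 0 (ℕ.*-monoˡ-≤ 1 m≤n)

p≤p+q : ∀ {p q} → 0ℚ ≤ q → p ≤ p + q
p≤p+q {p} {q} 0≤q = subst (_≤ p + q) (ℚ.+-identityʳ p) (ℚ.+-monoʳ-≤ p 0≤q)

p≤q+p : ∀ {p q} → 0ℚ ≤ q → p ≤ q + p
p≤q+p {p} {q} 0≤q = subst (_≤ q + p) (ℚ.+-identityˡ p) (ℚ.+-monoˡ-≤ p 0≤q)

*-nonNeg : ∀ {p q} → 0ℚ ≤ p → 0ℚ ≤ q → 0ℚ ≤ p * q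
*-nonNeg {p} {q} 0≤p 0≤q = subst (_≤ p * q) (ℚ.*-zeroʳ p) (ℚ.*-monoˡ-≤-nonNeg p {{nonNegative 0≤p}} 0≤q)

*-mono-≤-nonNeg : ∀ {p q r s} → 0ℚ ≤ q → 0ℚ ≤ r → p ≤ q → r ≤ s → p * r ≤ q * s
*-mono-≤-nonNeg {p} {q} {r} {s} 0≤q 0≤r p≤q r≤s = ℚ.≤-trans
  (ℚ.*-monoʳ-≤-nonNeg r {{nonNegative 0≤r}} p≤q) (ℚ.*-monoˡ-≤-nonNeg q {{nonNegative 0≤q}} r≤s)

∑< : ℕ → (ℕ → ℚ) → ℚ
∑< n f = Sum.sum {n} (f ∘ toℕ)

syntax ∑< n (λ i → e) = ∑[ i < n ] e

∑-suc : ∀ n (f : ℕ → ℚ) → ∑< (suc n) f ≡ ∑< n f + f n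
∑-suc n f = begin
  ∑< (suc n) f                                                 ≡⟨ Sum.sum-init-last {n} (f ∘ toℕ) ⟩
  Sum.sum {n} (f ∘ toℕ ∘ Fin.inject₁) + f (toℕ (Fin.fromℕ n))  ≡⟨ cong₂ _+_ (Sum.sum-cong-≗ {n} (cong f ∘ Fin.toℕ-inject₁))
                                                                            (cong f (Fin.toℕ-fromℕ n)) ⟩
  ∑< n f + f n                                                 ∎
  where open ≡-Reasoning

∑-cong : ∀ n {f g : ℕ → ℚ} → (∀ i → f i ≡ g i) → ∑< n f ≡ ∑< n g
∑-cong n f≗g = Sum.sum-cong-≗ {n} (f≗g ∘ toℕ)

∑-mono-≤ : ∀ n {f g : ℕ → ℚ} → (∀ i → i ℕ.< n → f i ≤ g i) → ∑< n f ≤ ∑< n g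
∑-mono-≤ zero    f≤g = ℚ.≤-refl
∑-mono-≤ (suc n) f≤g = ℚ.+-mono-≤ (f≤g 0 (s≤s z≤n)) (∑-mono-≤ n (λ i i<n → f≤g (suc i) (s≤s i<n)))

∑-nonNeg : ∀ n {f : ℕ → ℚ} → (∀ i → 0ℚ ≤ f i) → 0ℚ ≤ ∑< n f
∑-nonNeg zero    f≥0 = ℚ.≤-refl
∑-nonNeg (suc n) f≥0 = ℚ.+-mono-≤ (f≥0 0) (∑-nonNeg n (f≥0 ∘ suc))

summand≤∑ : ∀ {f : ℕ → ℚ} → (∀ i → 0ℚ ≤ f i) → ∀ {i n} → i ℕ.< n → f i ≤ ∑< n f
summand≤∑ f≥0 {zero}  {suc n} _         = p≤p+q (∑-nonNeg n (f≥0 ∘ suc))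
summand≤∑ f≥0 {suc i} {suc n} (s≤s i<n) = ℚ.≤-trans (summand≤∑ (f≥0 ∘ suc) i<n) (p≤q+p (f≥0 0))

∑-monoˡ-≤ : ∀ {f : ℕ → ℚ} → (∀ i → 0ℚ ≤ f i) → ∀ {m n} → m ℕ.≤ n → ∑< m f ≤ ∑< n f
∑-monoˡ-≤ f≥0 {zero}  {n}     _         = ∑-nonNeg n f≥0
∑-monoˡ-≤ {f} f≥0 {suc m} {suc n} (s≤s m≤n) = ℚ.+-monoʳ-≤ (f 0) (∑-monoˡ-≤ (f≥0 ∘ suc) m≤n)

∑-comm : ∀ m n (f : ℕ → ℕ → ℚ) → ∑[ i < m ] ∑[ j < n ] f i j ≡ ∑[ j < n ] ∑[ i < m ] f i j
∑-comm m n f = Sum.∑-comm {m} {n} (λ i j → f (toℕ i) (toℕ j))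

∑-*-∑ : ∀ m n (a b : ℕ → ℚ) → ∑[ i < m ] ∑[ j < n ] (a i * b j) ≡ ∑< m a * ∑< n b
∑-*-∑ m n a b = begin
  ∑[ i < m ] ∑[ j < n ] (a i * b j)  ≡⟨ ∑-cong m (λ i → Sum.*-distribˡ-sum {n} (a i) (b ∘ toℕ)) ⟨
  ∑[ i < m ] (a i * ∑< n b)          ≡⟨ Sum.*-distribʳ-sum {m} (∑< n b) (a ∘ toℕ) ⟨
  ∑< m a * ∑< n b                    ∎
  where open ≡-Reasoning

∑-const : ∀ n m → ∑[ i < n ] ℓℚ m ≡ ℓℚ (n ℕ.* m)
∑-const zero    m = refl
∑-const (suc n) m = trans (cong (λ s → ℓℚ m + s) (∑-const n m)) (sym (ℓℚ-+ m (n ℕ.* m)))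

-- 1/d², with junk value 0 at d = 0
1/sq : ℕ → ℚ
1/sq zero    = 0ℚ
1/sq (suc k) = + 1 / (suc k ℕ.* suc k)

1/sq-nonNeg : ∀ d → 0ℚ ≤ 1/sq d
1/sq-nonNeg zero    = ℚ.≤-refl
1/sq-nonNeg (suc k) = /-nonNeg 1 (k ℕ.+ k ℕ.* suc k)

1/sq-* : ∀ m n → 1/sq (suc m ℕ.* suc n) ≡ 1/sq (suc m) * 1/sq (suc n)
1/sq-* m n = sym (trans (/-*-/ 1 M 1 N) (/-≡-cross 1 (ℕ.pred (suc M ℕ.* suc N)) 1 MN eq))
  where
  M N MN : ℕ
  M = ℕ.pred (suc m ℕ.* suc m)
  N = ℕ.pred (suc n ℕ.* suc n)
  MN = ℕ.pred (suc m ℕ.* suc n ℕ.* (suc m ℕ.* suc n))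
  eq : 1 ℕ.* 1 ℕ.* (suc m ℕ.* suc n ℕ.* (suc m ℕ.* suc n)) ≡ 1 ℕ.* (suc m ℕ.* suc m ℕ.* (suc n ℕ.* suc n))
  eq = solve (m ∷ n ∷ [])

1/sq+1/n≤1/[n-1] : ∀ m → 1/sq (suc (suc m)) + + 1 / suc (suc m) ≤ + 1 / suc m
1/sq+1/n≤1/[n-1] m = subst (_≤ + 1 / suc m) (sym (/-+-/ 1 (ℕ.pred (n ℕ.* n)) 1 (suc m)))
  (/-≤-cross (1 ℕ.* n ℕ.+ 1 ℕ.* (n ℕ.* n)) (ℕ.pred (n ℕ.* n ℕ.* n)) 1 m
    (ℕ.≤-trans (ℕ.m≤m+n _ n) (ℕ.≤-reflexive (num*[n-1]+n≡n³ m))))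
  where
  n : ℕ
  n = suc (suc m)
  num*[n-1]+n≡n³ : ∀ j → (1 ℕ.* suc (suc j) ℕ.+ 1 ℕ.* (suc (suc j) ℕ.* suc (suc j))) ℕ.* suc j ℕ.+ suc (suc j)
                         ≡ 1 ℕ.* (suc (suc j) ℕ.* suc (suc j) ℕ.* suc (suc j))
  num*[n-1]+n≡n³ = solve-∀

∑-1/sq+1/n≤2 : ∀ m → ∑[ k < suc m ] 1/sq (suc k) + + 1 / suc m ≤ ℓℚ 2
∑-1/sq+1/n≤2 zero    = ℚ.≤-refl
∑-1/sq+1/n≤2 (suc m) = begin
  ∑[ k < suc (suc m) ] 1/sq (suc k) + + 1 / suc (suc m)                   ≡⟨ cong (_+ + 1 / suc (suc m)) (∑-suc (suc m) (1/sq ∘ suc)) ⟩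
  ∑[ k < suc m ] 1/sq (suc k) + 1/sq (suc (suc m)) + + 1 / suc (suc m)    ≡⟨ ℚ.+-assoc (∑[ k < suc m ] 1/sq (suc k)) _ _ ⟩
  ∑[ k < suc m ] 1/sq (suc k) + (1/sq (suc (suc m)) + + 1 / suc (suc m))  ≤⟨ ℚ.+-monoʳ-≤ (∑[ k < suc m ] 1/sq (suc k)) (1/sq+1/n≤1/[n-1] m) ⟩
  ∑[ k < suc m ] 1/sq (suc k) + + 1 / suc m                               ≤⟨ ∑-1/sq+1/n≤2 m ⟩
  ℓℚ 2                                                                    ∎
  where open ℚ.≤-Reasoning

∑-1/sq≤2 : ∀ n → ∑[ k < n ] 1/sq (suc k) ≤ ℓℚ 2
∑-1/sq≤2 zero    = ℚ.nonNegative⁻¹ (ℓℚ 2)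
∑-1/sq≤2 (suc m) = ℚ.≤-trans (p≤p+q (/-nonNeg 1 m)) (∑-1/sq+1/n≤2 m)

onMultiplesOf : ℕ → (ℕ → ℚ) → ℕ → ℚ
onMultiplesOf m f n with m ∣? n
... | yes _ = f n
... | no  _ = 0ℚ

onMultiplesOf-∣ : ∀ {m n} f → m ∣ n → onMultiplesOf m f n ≡ f n
onMultiplesOf-∣ {m} {n} f m∣n with m ∣? n
... | yes _   = refl
... | no  m∤n = ⊥-elim (m∤n m∣n)

onMultiplesOf-∤ : ∀ {m n} f → ¬ m ∣ n → onMultiplesOf m f n ≡ 0ℚ
onMultiplesOf-∤ {m} {n} f m∤n with m ∣? n
... | yes m∣n = ⊥-elim (m∤n m∣n)
... | no  _   = refl

onMultiplesOf-nonNeg : ∀ m {f} → (∀ n → 0ℚ ≤ f n) → ∀ n → 0ℚ ≤ onMultiplesOf m f n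
onMultiplesOf-nonNeg m f≥0 n with m ∣? n
... | yes _ = f≥0 n
... | no  _ = ℚ.≤-refl

∑-onMultiplesOf : ∀ e {f} → (∀ n → 0ℚ ≤ f n) → ∀ N → ∃[ q ]
  (suc e ℕ.* q ℕ.≤ N × ∑[ i < N ] onMultiplesOf (suc e) f (suc i) ≤ ∑[ k < q ] f (suc e ℕ.* suc k))
∑-onMultiplesOf e f≥0 zero = 0 , ℕ.≤-reflexive (ℕ.*-zeroʳ (suc e)) , ℚ.≤-refl
∑-onMultiplesOf e {f} f≥0 (suc N) with ∑-onMultiplesOf e f≥0 N | suc e ∣? suc N
... | q , [e+1]q≤N , ∑≤ | no e+1∤N+1 = q , ℕ.m≤n⇒m≤1+n [e+1]q≤N , (begin
  ∑< (suc N) g     ≡⟨ ∑-suc N g ⟩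
  ∑< N g + g N     ≡⟨ cong (λ t → ∑< N g + t) (onMultiplesOf-∤ f e+1∤N+1) ⟩
  ∑< N g + 0ℚ      ≡⟨ ℚ.+-identityʳ (∑< N g) ⟩
  ∑< N g           ≤⟨ ∑≤ ⟩
  ∑< q (f ∘ (suc e ℕ.*_) ∘ suc) ∎)
  where
  open ℚ.≤-Reasoning
  g : ℕ → ℚ
  g = onMultiplesOf (suc e) f ∘ suc
... | q , [e+1]q≤N , ∑≤ | yes e+1∣N+1@(divides (suc K) N+1≡[K+1][e+1]) = suc K , ℕ.≤-reflexive (sym N+1≡[e+1][K+1]) , (begin
  ∑< (suc N) g                 ≡⟨ ∑-suc N g ⟩
  ∑< N g + g N                 ≡⟨ cong (λ t → ∑< N g + t) (trans (onMultiplesOf-∣ f e+1∣N+1) (cong f N+1≡[e+1][K+1])) ⟩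
  ∑< N g + h K                 ≤⟨ ℚ.+-monoˡ-≤ (h K) (ℚ.≤-trans ∑≤ (∑-monoˡ-≤ (f≥0 ∘ (suc e ℕ.*_) ∘ suc) q≤K)) ⟩
  ∑< K h + h K                 ≡⟨ ∑-suc K h ⟨
  ∑< (suc K) h                 ∎)
  where
  open ℚ.≤-Reasoning
  g h : ℕ → ℚ
  g = onMultiplesOf (suc e) f ∘ suc
  h = f ∘ (suc e ℕ.*_) ∘ suc
  N+1≡[e+1][K+1] : suc N ≡ suc e ℕ.* suc K
  N+1≡[e+1][K+1] = trans N+1≡[K+1][e+1] (ℕ.*-comm (suc K) (suc e))
  q≤K : q ℕ.≤ K
  q≤K = ℕ.s≤s⁻¹ (ℕ.*-cancelˡ-< (suc e) q (suc K) (subst (suc e ℕ.* q ℕ.<_) N+1≡[e+1][K+1] (s≤s [e+1]q≤N)))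

-- gcd(d, ℓ) is itself one of the common divisors e + 1 summed over.
term≤∑-common-divisors : ∀ ℓ k N → k ℕ.< N → term ℓ k ≤
  ∑[ e < N ] (onMultiplesOf (suc e) (λ _ → ℓℚ (suc e)) ℓ * onMultiplesOf (suc e) 1/sq (suc k))
term≤∑-common-divisors ℓ k N k<N = begin
  term ℓ k                           ≡⟨ /≡ℓℚ*1/ g (k ℕ.+ k ℕ.* suc k) ⟩
  ℓℚ g * 1/sq (suc k)                ≡⟨ cong (λ g → ℓℚ g * 1/sq (suc k)) e+1≡g ⟨
  ℓℚ (suc e) * 1/sq (suc k)          ≡⟨ cong₂ _*_ (onMultiplesOf-∣ (λ _ → ℓℚ (suc e)) e+1∣ℓ) (onMultiplesOf-∣ 1/sq e+1∣k+1) ⟨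
  summand e                          ≤⟨ summand≤∑ summand-nonNeg (ℕ.≤-trans (∣⇒≤ e+1∣k+1) k<N) ⟩
  ∑< N summand                       ∎
  where
  open ℚ.≤-Reasoning
  g e : ℕ
  g = gcd (suc k) ℓ
  e = ℕ.pred g
  e+1≡g : suc e ≡ g
  e+1≡g = ℕ.suc-pred g {{ℕ.≢-nonZero (gcd[m,n]≢0 (suc k) ℓ (inj₁ λ ()))}}
  e+1∣ℓ : suc e ∣ ℓ
  e+1∣ℓ = subst (_∣ ℓ) (sym e+1≡g) (gcd[m,n]∣n (suc k) ℓ)
  e+1∣k+1 : suc e ∣ suc k
  e+1∣k+1 = subst (_∣ suc k) (sym e+1≡g) (gcd[m,n]∣m (suc k) ℓ)
  summand : ℕ → ℚ
  summand e = onMultiplesOf (suc e) (λ _ → ℓℚ (suc e)) ℓ * onMultiplesOf (suc e) 1/sq (suc k)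
  summand-nonNeg : ∀ e → 0ℚ ≤ summand e
  summand-nonNeg e = *-nonNeg (onMultiplesOf-nonNeg (suc e) (λ _ → /-nonNeg (suc e) 0) ℓ)
                              (onMultiplesOf-nonNeg (suc e) 1/sq-nonNeg (suc k))

∑-onMultiplesOf-self≤ : ∀ e Y → ∑[ j < Y ] onMultiplesOf (suc e) (λ _ → ℓℚ (suc e)) (suc j) ≤ ℓℚ Y
∑-onMultiplesOf-self≤ e Y with ∑-onMultiplesOf e (λ _ → /-nonNeg (suc e) 0) Y
... | q , [e+1]q≤Y , ∑≤ = begin
  ∑[ j < Y ] onMultiplesOf (suc e) (λ _ → ℓℚ (suc e)) (suc j) ≤⟨ ∑≤ ⟩
  ∑[ k < q ] ℓℚ (suc e)                                      ≡⟨ ∑-const q (suc e) ⟩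
  ℓℚ (q ℕ.* suc e)                                           ≤⟨ ℓℚ-mono-≤ (subst (ℕ._≤ Y) (ℕ.*-comm (suc e) q) [e+1]q≤Y) ⟩
  ℓℚ Y                                                       ∎
  where open ℚ.≤-Reasoning

∑-onMultiplesOf-1/sq≤ : ∀ e N → ∑[ k < N ] onMultiplesOf (suc e) 1/sq (suc k) ≤ ℓℚ 2 * 1/sq (suc e)
∑-onMultiplesOf-1/sq≤ e N with ∑-onMultiplesOf e 1/sq-nonNeg N
... | q , _ , ∑≤ = begin
  ∑[ k < N ] onMultiplesOf (suc e) 1/sq (suc k)    ≤⟨ ∑≤ ⟩
  ∑[ k < q ] 1/sq (suc e ℕ.* suc k)                ≡⟨ ∑-cong q (1/sq-* e) ⟩
  ∑[ k < q ] (1/sq (suc e) * 1/sq (suc k))         ≡⟨ Sum.*-distribˡ-sum {q} (1/sq (suc e)) (1/sq ∘ suc ∘ toℕ) ⟨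
  1/sq (suc e) * ∑[ k < q ] 1/sq (suc k)           ≤⟨ ℚ.*-monoˡ-≤-nonNeg (1/sq (suc e)) {{nonNegative (1/sq-nonNeg (suc e))}} (∑-1/sq≤2 q) ⟩
  1/sq (suc e) * ℓℚ 2                              ≡⟨ ℚ.*-comm (1/sq (suc e)) (ℓℚ 2) ⟩
  ℓℚ 2 * 1/sq (suc e)                              ∎
  where open ℚ.≤-Reasoning

cPartial≡∑ : ∀ ℓ N → cPartial ℓ N ≡ ∑< N (term ℓ)
cPartial≡∑ ℓ zero    = refl
cPartial≡∑ ℓ (suc N) = trans (cong (_+ term ℓ N) (cPartial≡∑ ℓ N)) (sym (∑-suc N (term ℓ)))

cPartial-nonNeg : ∀ ℓ N → 0ℚ ≤ cPartial ℓ N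
cPartial-nonNeg ℓ N = subst (0ℚ ≤_) (sym (cPartial≡∑ ℓ N)) (∑-nonNeg N (λ k → /-nonNeg (gcd (suc k) ℓ) (k ℕ.+ k ℕ.* suc k)))

∑-cPartial≤ : ∀ N Y → ∑[ j < Y ] cPartial (suc j) N ≤ ℓℚ 4 * ℓℚ Y
∑-cPartial≤ N Y = begin
  ∑[ j < Y ] cPartial (suc j) N                                  ≡⟨ ∑-cong Y (λ j → cPartial≡∑ (suc j) N) ⟩
  ∑[ j < Y ] ∑[ k < N ] term (suc j) k                           ≤⟨ ∑-mono-≤ Y (λ j _ → ∑-mono-≤ N (λ k k<N → term≤∑-common-divisors (suc j) k N k<N)) ⟩
  ∑[ j < Y ] ∑[ k < N ] ∑[ e < N ] (a e (suc j) * b e (suc k))   ≡⟨ ∑-cong Y (λ j → ∑-comm N N (λ k e → a e (suc j) * b e (suc k))) ⟩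
  ∑[ j < Y ] ∑[ e < N ] ∑[ k < N ] (a e (suc j) * b e (suc k))   ≡⟨ ∑-comm Y N (λ j e → ∑[ k < N ] (a e (suc j) * b e (suc k))) ⟩
  ∑[ e < N ] ∑[ j < Y ] ∑[ k < N ] (a e (suc j) * b e (suc k))   ≡⟨ ∑-cong N (λ e → ∑-*-∑ Y N (a e ∘ suc) (b e ∘ suc)) ⟩
  ∑[ e < N ] (∑[ j < Y ] a e (suc j) * ∑[ k < N ] b e (suc k))   ≤⟨ ∑-mono-≤ N (λ e _ → *-mono-≤-nonNeg (/-nonNeg Y 0) (∑-nonNeg N (b-nonNeg e ∘ suc))
                                                                      (∑-onMultiplesOf-self≤ e Y) (∑-onMultiplesOf-1/sq≤ e N)) ⟩
  ∑[ e < N ] (ℓℚ Y * (ℓℚ 2 * 1/sq (suc e)))                      ≡⟨ ∑-cong N (λ e → ℚ.*-assoc (ℓℚ Y) (ℓℚ 2) (1/sq (suc e))) ⟨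
  ∑[ e < N ] (ℓℚ Y * ℓℚ 2 * 1/sq (suc e))                        ≡⟨ Sum.*-distribˡ-sum {N} (ℓℚ Y * ℓℚ 2) (1/sq ∘ suc ∘ toℕ) ⟨
  ℓℚ Y * ℓℚ 2 * ∑[ e < N ] 1/sq (suc e)                          ≤⟨ ℚ.*-monoˡ-≤-nonNeg (ℓℚ Y * ℓℚ 2) {{nonNegative (*-nonNeg (/-nonNeg Y 0) (/-nonNeg 2 0))}} (∑-1/sq≤2 N) ⟩
  ℓℚ Y * ℓℚ 2 * ℓℚ 2                                             ≡⟨ ℚ.*-assoc (ℓℚ Y) (ℓℚ 2) (ℓℚ 2) ⟩
  ℓℚ Y * ℓℚ 4                                                    ≡⟨ ℚ.*-comm (ℓℚ Y) (ℓℚ 4) ⟩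
  ℓℚ 4 * ℓℚ Y                                                    ∎
  where
  open ℚ.≤-Reasoning
  a b : ℕ → ℕ → ℚ
  a e = onMultiplesOf (suc e) (λ _ → ℓℚ (suc e))
  b e = onMultiplesOf (suc e) 1/sq
  b-nonNeg : ∀ e n → 0ℚ ≤ b e n
  b-nonNeg e = onMultiplesOf-nonNeg (suc e) 1/sq-nonNeg

-- k is the largest window element below M (or 0); ℓ = 0 never lies in the window since X > 0.
windowSum≤∑-cPartial : ∀ {X} → 0ℚ < X → ∀ N M → ∃[ k ]
  (k ℕ.≤ ℕ.pred M × ℓℚ k ≤ ℓℚ 2 * X × windowSum X N M ≤ ∑[ j < k ] cPartial (suc j) N)
windowSum≤∑-cPartial 0<X N zero = 0 , z≤n , *-nonNeg (/-nonNeg 2 0) (ℚ.<⇒≤ 0<X) , ℚ.≤-refl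
windowSum≤∑-cPartial {X} 0<X N (suc zero) with (X ≤? ℓℚ 0) ×-dec (ℓℚ 0 ≤? ℓℚ 2 * X)
... | yes (X≤0 , _) = ⊥-elim (ℚ.<-irrefl refl (ℚ.<-≤-trans 0<X X≤0))
... | no  _         = windowSum≤∑-cPartial 0<X N zero
windowSum≤∑-cPartial {X} 0<X N (suc (suc m))
  with (X ≤? ℓℚ (suc m)) ×-dec (ℓℚ (suc m) ≤? ℓℚ 2 * X) | windowSum≤∑-cPartial 0<X N (suc m)
... | yes (_ , m+1≤2X) | k , k≤m , _ , window≤ = suc m , ℕ.≤-refl , m+1≤2X , (begin
  windowSum X N (suc m) + cPartial (suc m) N                ≤⟨ ℚ.+-monoˡ-≤ (cPartial (suc m) N) window≤ ⟩
  ∑[ j < k ] cPartial (suc j) N + cPartial (suc m) N        ≤⟨ ℚ.+-monoˡ-≤ (cPartial (suc m) N) (∑-monoˡ-≤ (λ j → cPartial-nonNeg (suc j) N) k≤m) ⟩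
  ∑[ j < m ] cPartial (suc j) N + cPartial (suc m) N        ≡⟨ ∑-suc m (λ j → cPartial (suc j) N) ⟨
  ∑[ j < suc m ] cPartial (suc j) N                         ∎)
  where open ℚ.≤-Reasoning
... | no _ | k , k≤m , k≤2X , window≤ = k , ℕ.m≤n⇒m≤1+n k≤m , k≤2X , window≤

lemma6 : Σ ℚ (λ c → (0ℚ < c) × ((X : ℚ) → 1ℚ ≤ X → (N M : ℕ) → windowSum X N M ≤ c * X))
lemma6 = ℓℚ 8 , ℚ.positive⁻¹ (ℓℚ 8) , windowSum≤8X
  where
  windowSum≤8X : (X : ℚ) → 1ℚ ≤ X → (N M : ℕ) → windowSum X N M ≤ ℓℚ 8 * X
  windowSum≤8X X 1≤X N M with windowSum≤∑-cPartial (ℚ.<-≤-trans (ℚ.positive⁻¹ 1ℚ) 1≤X) N M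
  ... | k , _ , k≤2X , window≤ = begin
    windowSum X N M                  ≤⟨ window≤ ⟩
    ∑[ j < k ] cPartial (suc j) N    ≤⟨ ∑-cPartial≤ N k ⟩
    ℓℚ 4 * ℓℚ k                      ≤⟨ ℚ.*-monoˡ-≤-nonNeg (ℓℚ 4) k≤2X ⟩
    ℓℚ 4 * (ℓℚ 2 * X)                ≡⟨ ℚ.*-assoc (ℓℚ 4) (ℓℚ 2) X ⟨
    ℓℚ 8 * X                         ∎
    where open ℚ.≤-Reasoning
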